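{- Let $S=\langle d_0,d_1,d_2,d_3\rangle$ be a numerical semigroup with embedding dimension four, and suppose the coefficients of the minimal relations $a_{ii}d_i=\sum_{j\ne i}a_{ij}d_j$ ($i=1,2,3$) are chosen such that at most one of $a_{10},a_{20},a_{30}$ equals $0$. Let $V$ be as in the context and let $(-\lambda_1,\lambda_2,\lambda_3)\in V$ satisfy $\lambda_0d_0+\lambda_1d_1=\lambda_2d_2+\lambda_3d_3$ with all $\lambda_i>0$, and $\lambda_0\ge a_{00}$ or $\lambda_1\ge a_{11}$. If $a_{00}d_0\ne a_{11}d_1$, then $\lambda_0d_0+\lambda_1d_1\notin\mathrm{Betti}(S)$. If $a_{00}d_0=a_{11}d_1$, then $\lambda_0d_0+\lambda_1d_1\in\mathrm{Betti}(S)$ and $$\varphi^{ -1}(\lambda_0d_0+\lambda_1d_1)=\{(0,0,\lambda_2,\lambda_3)\}\cup\{(\lambda_0+\lambda a_{00},\lambda_1-\lambda a_{11},0,0):\lambda\in\mathbb Z,\ \lambda_0+\lambda a_{00}\ge0,\ \lambda_1-\lambda a_{11}\ge0\}.$$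
   Context: $S$ is the set of nonnegative integer combinations of its minimal generators $d_0,\dots,d_3$ ($\gcd=1$); $\mathrm{Ap}(S,d_0)=\{s\in S:s-d_0\notin S\}$. For $i\in\{0,1,2,3\}$, $a_{ii}$ is the least positive integer with $a_{ii}d_i=\sum_{j\ne i}a_{ij}d_j$ for some $a_{ij}\in\mathbb N$ (the $a_{ij}$ are fixed). Cubes $[[i,j,k]]$, $(i,j,k)\in\mathbb N^3$, are labeled $id_1+jd_2+kd_3$; the initial collection consists of all of them; deleting the region associated to $(a,b,c)\in\mathbb Z^3$ removes all cubes with $i\ge a,j\ge b,k\ge c$. $T$ is the set of cubes $[[i,j,k]]$ with label in $\mathrm{Ap}(S,d_0)$ and $i<a_{11}$, $j<a_{22}$, $k<a_{33}$. $V$ is a minimal set of points $(x,y,z)\in\mathbb Z^3$ with $xd_1+yd_2+zd_3$ a nonnegative multiple of $d_0$ such that deleting their associated regions from the initial collection leaves exactly $T$. $\varphi:\mathbb N^4\to S$, $\varphi(z)=\sum z_id_i$; $\mathrm{supp}(z)=\{i:z_i>0\}$; $z,z'$ are $\mathcal R$-related if joined by a sequence in $\mathbb N^4$ with consecutive supports intersecting; $s$ is a Betti element if $\varphi^{ -1}(s)$ contains two non-$\mathcal R$-related elements. -}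

module Defs where

open import Data.Nat using (ℕ; zero; suc; _+_; _*_; _∸_; _≤_; _<_)
open import Data.Nat.GCD using (gcd)
open import Data.Integer as ℤ using (ℤ; +_)
open import Data.Fin using (Fin; _≟_)
open import Data.Fin.Patterns using (0F; 1F; 2F; 3F)
open import Data.Vec using (Vec; lookup; tabulate; _∷_; [])
open import Data.Product using (Σ; ∃; ∃-syntax; _×_; _,_)
open import Data.Sum using (_⊎_)
open import Relation.Nullary using (¬_; yes; no)
open import Relation.Binary.PropositionalEquality using (_≡_)
open import Relation.Binary.Construct.Closure.ReflexiveTransitive using (Star)
open import Level using (0ℓ)

φ : Vec ℕ 4 → Vec ℕ 4 → ℕ
φ d z = lookup z 0F * lookup d 0F + lookup z 1F * lookup d 1F
      + lookup z 2F * lookup d 2F + lookup z 3F * lookup d 3F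

InS : Vec ℕ 4 → ℕ → Set
InS d s = ∃[ z ] φ d z ≡ s

InSWithout : Vec ℕ 4 → Fin 4 → ℕ → Set
InSWithout d i s = ∃[ z ] (lookup z i ≡ 0 × φ d z ≡ s)

EmbDim4 : Vec ℕ 4 → Set
EmbDim4 d = gcd (gcd (lookup d 0F) (lookup d 1F)) (gcd (lookup d 2F) (lookup d 3F)) ≡ 1
          × (∀ (i : Fin 4) → ¬ InSWithout d i (lookup d i))

InApery : Vec ℕ 4 → ℕ → Set
InApery d s = InS d s × ¬ (lookup d 0F ≤ s × InS d (s ∸ lookup d 0F))

offDiag : (Fin 4 → Fin 4 → ℕ) → Fin 4 → Vec ℕ 4
offDiag a i = tabulate (λ j → f j (j ≟ i))
  where
  f : (j : Fin 4) → _ → ℕ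
  f j (yes _) = 0
  f j (no _)  = a i j

MinimalRelations : Vec ℕ 4 → (Fin 4 → Fin 4 → ℕ) → Set
MinimalRelations d a = ∀ (i : Fin 4) →
    (0 < a i i)
  × (a i i * lookup d i ≡ φ d (offDiag a i))
  × (∀ (m : ℕ) → 0 < m → InSWithout d i (m * lookup d i) → a i i ≤ m)

AtMostOneZero : ℕ → ℕ → ℕ → Set
AtMostOneZero x y z = ¬ (x ≡ 0 × y ≡ 0) × ¬ (x ≡ 0 × z ≡ 0) × ¬ (y ≡ 0 × z ≡ 0)

InT : Vec ℕ 4 → (Fin 4 → Fin 4 → ℕ) → ℕ → ℕ → ℕ → Set
InT d a i j k = InApery d (i * lookup d 1F + j * lookup d 2F + k * lookup d 3F)
              × i < a 1F 1F × j < a 2F 2F × k < a 3F 3F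

Point : Set
Point = ℤ × ℤ × ℤ

PointSet : Set₁
PointSet = Point → Set

Admissible : Vec ℕ 4 → Point → Set
Admissible d (x , y , z) =
  ∃[ m ] (x ℤ.* + lookup d 1F ℤ.+ y ℤ.* + lookup d 2F ℤ.+ z ℤ.* + lookup d 3F ≡ + (m * lookup d 0F))

-- the region associated to (x,y,z) contains the cube [[i,j,k]]
Covers : Point → ℕ → ℕ → ℕ → Set
Covers (x , y , z) i j k = x ℤ.≤ + i × y ℤ.≤ + j × z ℤ.≤ + k

-- deleting the regions of the points of W from all cubes leaves exactly T
Leaves : Vec ℕ 4 → (Fin 4 → Fin 4 → ℕ) → PointSet → Set
Leaves d a W = ∀ (i j k : ℕ) →
  (InT d a i j k → ¬ (∃[ v ] (W v × Covers v i j k)))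
  × (¬ (∃[ v ] (W v × Covers v i j k)) → InT d a i j k)

GoodSet : Vec ℕ 4 → (Fin 4 → Fin 4 → ℕ) → PointSet → Set
GoodSet d a W = (∀ v → W v → Admissible d v) × Leaves d a W

IsV : Vec ℕ 4 → (Fin 4 → Fin 4 → ℕ) → PointSet → Set₁
IsV d a V = GoodSet d a V
  × (∀ (W : PointSet) → (∀ v → W v → V v) → GoodSet d a W → ∀ v → V v → W v)

SuppMeet : Vec ℕ 4 → Vec ℕ 4 → Set
SuppMeet z z' = ∃[ i ] (0 < lookup z i × 0 < lookup z' i)

RStep : Vec ℕ 4 → ℕ → Vec ℕ 4 → Vec ℕ 4 → Set
RStep d s z z' = φ d z ≡ s × φ d z' ≡ s × SuppMeet z z'

RRel : Vec ℕ 4 → ℕ → Vec ℕ 4 → Vec ℕ 4 → Set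
RRel d s = Star (RStep d s)

IsBetti : Vec ℕ 4 → ℕ → Set
IsBetti d s = ∃[ z ] ∃[ z' ] (φ d z ≡ s × φ d z' ≡ s × ¬ RRel d s z z')

InClaimedFiber : (Fin 4 → Fin 4 → ℕ) → ℕ → ℕ → ℕ → ℕ → Vec ℕ 4 → Set
InClaimedFiber a l0 l1 l2 l3 z =
  (z ≡ 0 ∷ 0 ∷ l2 ∷ l3 ∷ [])
  ⊎ (∃[ t ] (+ l0 ℤ.+ t ℤ.* + a 0F 0F ℤ.≥ + 0
           × + l1 ℤ.- t ℤ.* + a 1F 1F ℤ.≥ + 0
           × + lookup z 0F ≡ + l0 ℤ.+ t ℤ.* + a 0F 0F
           × + lookup z 1F ≡ + l1 ℤ.- t ℤ.* + a 1F 1F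
           × lookup z 2F ≡ 0 × lookup z 3F ≡ 0))

-- Write s = λ₀d₀ + λ₁d₁. Minimality of V makes the point (−λ₁, λ₂, λ₃) essential, so every cube
-- that only it deletes lies in T; in particular [[0, λ₂−1, λ₃]] and [[0, λ₂, λ₃−1]] do. Hence
-- s − d₂, s − d₃ ∈ Ap(S, d₀), λ₂ < a₂₂ and λ₃ < a₃₃: no factorisation of s uses d₀ together with
-- d₂ or d₃, and (0, 0, λ₂, λ₃) is the only one without d₀ and with fewer than a₁₁ copies of d₁.
-- If a₀₀d₀ = a₁₁d₁, trading a₁₁d₁ for a₀₀d₀ shows that (0, 0, λ₂, λ₃) is the only factorisation
-- meeting d₂ or d₃, hence alone in its 𝓡-class, while the factorisations supported on {d₀, d₁}
-- form the orbit of (λ₀, λ₁) under that trade. Otherwise λ₀ ≥ a₀₀ (as λ₁ ≥ a₁₁ would force both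
-- minimal relations of d₀ and d₁ to be binomial in d₀, d₁, and binomial relations coincide), and
-- applying these relations to (λ₀, λ₁, 0, 0) produces a factorisation using d₁ and one of d₂, d₃,
-- which joins the two 𝓡-classes.
module Submission where

open import Defs
open import Algebra.Properties.CommutativeSemigroup using (x∙yz≈y∙xz; xy∙z≈xz∙y)
open import Data.Empty using (⊥; ⊥-elim)
open import Data.Fin using (Fin)
open import Data.Fin.Patterns using (0F; 1F; 2F; 3F)
open import Data.Integer as ℤ using (ℤ; +_; -_; +≤+)
import Data.Integer.Properties as ℤ
import Data.Integer.Tactic.RingSolver as ℤ-Solver
open import Data.Nat using (ℕ; zero; suc; _+_; _*_; _∸_; _≤_; _<_; _≤?_; _<?_; z≤n; z<s; NonZero; >-nonZero)
open import Data.Nat.DivMod using (_%_; _/_; m≡m%n+[m/n]*n; m%n<n)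
open import Data.Nat.Properties
open import Data.Nat.Tactic.RingSolver using (solve-∀)
open import Data.Product using (∃-syntax; _×_; _,_; proj₁; proj₂)
open import Data.Sum as Sum using (_⊎_; inj₁; inj₂)
open import Data.Vec using (Vec; lookup; _∷_; []; zipWith; replicate; _[_]≔_)
open import Data.Vec.Properties using (lookup∘update′; lookup-replicate)
open import Function using (_∘_; id)
open import Relation.Binary.Construct.Closure.ReflexiveTransitive using (ε; _◅_; _◅◅_; fold; reverse)
open import Relation.Binary.PropositionalEquality
  using (_≡_; _≢_; refl; sym; trans; cong; cong₂; subst; module ≡-Reasoning)
open import Relation.Nullary using (¬_; yes; no; contradiction)
open import Relation.Nullary.Decidable using (decidable-stable)

open ≡-Reasoning

m+n*o≡p*o⇒m≡[p∸n]*o : ∀ m n o p → m + n * o ≡ p * o → m ≡ (p ∸ n) * o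
m+n*o≡p*o⇒m≡[p∸n]*o m n o p eq = begin
  m                  ≡⟨ m+n∸n≡m m (n * o) ⟨
  m + n * o ∸ n * o  ≡⟨ cong (_∸ n * o) eq ⟩
  p * o ∸ n * o      ≡⟨ *-distribʳ-∸ o p n ⟨
  (p ∸ n) * o        ∎

+-split : ∀ {m n} o → m ≤ n → n + o ≡ m + (n ∸ m + o)
+-split {m} {n} o m≤n = trans (cong (_+ o) (sym (m+[n∸m]≡n m≤n))) (+-assoc m (n ∸ m) o)

summand-< : ∀ {l m n o} → l ≡ m + n → l < o → n < o
summand-< {m = m} {n} refl = ≤-<-trans (m≤n+m n m)

positive-coefficient : ∀ {m x n y} → m * x ≡ n * y → 0 < m → 0 < x → 0 < n
positive-coefficient {suc _} {suc _} {suc _} _  _ _ = z<s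
positive-coefficient {suc _} {suc _} {zero}  () _ _

cancel-common-multiple : ∀ {X Y b} z l → X + z * b ≡ Y + l * b
  → (∃[ e ] z ≡ l + e × X + e * b ≡ Y) ⊎ (∃[ e ] l ≡ z + suc e × X ≡ Y + suc e * b)
cancel-common-multiple {X} {Y}     zero    zero    eq = inj₁ (0 , refl , trans eq (+-identityʳ Y))
cancel-common-multiple {X} {Y}     (suc z) zero    eq = inj₁ (suc z , refl , trans eq (+-identityʳ Y))
cancel-common-multiple {X} {Y}     zero    (suc l) eq = inj₂ (l , refl , trans (sym (+-identityʳ X)) eq)
cancel-common-multiple {X} {Y} {b} (suc z) (suc l) eq
  with cancel-common-multiple z l (+-cancelˡ-≡ b _ _ (begin
    b + (X + z * b)  ≡⟨ x∙yz≈y∙xz +-commutativeSemigroup X b (z * b) ⟨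
    X + suc z * b    ≡⟨ eq ⟩
    Y + suc l * b    ≡⟨ x∙yz≈y∙xz +-commutativeSemigroup Y b (l * b) ⟩
    b + (Y + l * b)  ∎))
... | inj₁ (e , refl , eq′) = inj₁ (e , refl , eq′)
... | inj₂ (e , refl , eq′) = inj₂ (e , refl , eq′)

pos-+-* : ∀ m n o → + (m + n * o) ≡ + m ℤ.+ + n ℤ.* + o
pos-+-* m n o = trans (ℤ.pos-+ m (n * o)) (cong (ℤ._+_ (+ m)) (ℤ.pos-* n o))

pos-*-+-* : ∀ m n o p → + (m * n + o * p) ≡ + m ℤ.* + n ℤ.+ + o ℤ.* + p
pos-*-+-* m n o p = trans (ℤ.pos-+ (m * n) (o * p)) (cong₂ ℤ._+_ (ℤ.pos-* m n) (ℤ.pos-* o p))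

module TwoTermEquation {A B α β : ℕ} ⦃ _ : NonZero α ⦄ ⦃ _ : NonZero B ⦄
  (relation : α * A ≡ β * B)
  (minimal : ∀ {r c} → 0 < r → r * A ≡ c * B → α ≤ r) where

  private
    remainder-vanishes : ∀ {r c w} → r < α → r * A + c * B ≡ w * B → r ≡ 0 × c ≡ w
    remainder-vanishes {zero}  {c} {w} _   eq = refl , *-cancelʳ-≡ c w B eq
    remainder-vanishes {suc r} {c} {w} r<α eq =
      contradiction (minimal {c = w ∸ c} z<s (m+n*o≡p*o⇒m≡[p∸n]*o (suc r * A) c B w eq)) (<⇒≱ r<α)

  multiples-of-relation : ∀ {u w} → u * A ≡ w * B → ∃[ q ] u ≡ q * α × w ≡ q * β
  multiples-of-relation {u} {w} uA≡wB = q , u≡qα , sym (proj₂ r≡0×qβ≡w)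
    where
    q r : ℕ
    q = u / α
    r = u % α
    u≡r+qα : u ≡ r + q * α
    u≡r+qα = m≡m%n+[m/n]*n u α
    expand : ∀ r q α A → (r + q * α) * A ≡ r * A + q * (α * A)
    expand = solve-∀
    r≡0×qβ≡w : r ≡ 0 × q * β ≡ w
    r≡0×qβ≡w = remainder-vanishes (m%n<n u α) (begin
      r * A + q * β * B    ≡⟨ cong (λ x → r * A + x) (*-assoc q β B) ⟩
      r * A + q * (β * B)  ≡⟨ cong (λ x → r * A + q * x) relation ⟨
      r * A + q * (α * A)  ≡⟨ expand r q α A ⟨
      (r + q * α) * A      ≡⟨ cong (_* A) u≡r+qα ⟨
      u * A                ≡⟨ uA≡wB ⟩
      w * B                ∎)
    u≡qα : u ≡ q * α
    u≡qα = trans u≡r+qα (cong (_+ q * α) (proj₁ r≡0×qβ≡w))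

  Orbit : ℕ → ℕ → ℕ → ℕ → ℤ → Set
  Orbit x y x₀ y₀ t = + x ≡ + x₀ ℤ.+ t ℤ.* + α × + y ≡ + y₀ ℤ.- t ℤ.* + β

  private
    orbit-step : ∀ {u y y₀} → u * A + y * B ≡ y₀ * B → ∃[ q ] u ≡ q * α × y₀ ≡ y + q * β
    orbit-step {u} {y} {y₀} eq with multiples-of-relation (m+n*o≡p*o⇒m≡[p∸n]*o (u * A) y B y₀ eq)
    ... | q , u≡qα , y₀∸y≡qβ = q , u≡qα , trans (sym (m+[n∸m]≡n y≤y₀)) (cong (_+_ y) y₀∸y≡qβ)
      where
      y≤y₀ : y ≤ y₀
      y≤y₀ = *-cancelʳ-≤ y y₀ B (subst (y * B ≤_) eq (m≤n+m (y * B) (u * A)))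

    orbit-≥ : ∀ {x y x₀ y₀} → x₀ ≤ x → x * A + y * B ≡ x₀ * A + y₀ * B
      → ∃[ t ] Orbit x y x₀ y₀ t
    orbit-≥ {x} {y} {x₀} {y₀} x₀≤x eq with m≤n⇒∃[o]m+o≡n x₀≤x
    ... | u , refl with orbit-step (+-cancelˡ-≡ (x₀ * A) _ _ (trans (sym regroup) eq))
      where
      regroup : (x₀ + u) * A + y * B ≡ x₀ * A + (u * A + y * B)
      regroup = trans (cong (_+ y * B) (*-distribʳ-+ A x₀ u)) (+-assoc (x₀ * A) (u * A) (y * B))
    ...   | q , u≡qα , y₀≡y+qβ = + q , trans (cong (λ v → + (x₀ + v)) u≡qα) (pos-+-* x₀ q α) , (begin
      + y                                     ≡⟨ cancel (+ y) (+ q ℤ.* + β) ⟩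
      (+ y ℤ.+ + q ℤ.* + β) ℤ.- + q ℤ.* + β   ≡⟨ cong (λ v → v ℤ.- + q ℤ.* + β) (pos-+-* y q β) ⟨
      + (y + q * β) ℤ.- + q ℤ.* + β           ≡⟨ cong (λ v → + v ℤ.- + q ℤ.* + β) y₀≡y+qβ ⟨
      + y₀ ℤ.- + q ℤ.* + β                    ∎)
      where
      cancel : ∀ Y Q → Y ≡ (Y ℤ.+ Q) ℤ.- Q
      cancel = ℤ-Solver.solve-∀

    orbit-sym : ∀ {x y x₀ y₀ t} → Orbit x₀ y₀ x y t → Orbit x y x₀ y₀ (- t)
    orbit-sym {x} {y} {x₀} {y₀} {t} (x₀≡ , y₀≡) =
        trans (undo₁ (+ x) t (+ α)) (cong (λ v → v ℤ.+ - t ℤ.* + α) (sym x₀≡))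
      , trans (undo₂ (+ y) t (+ β)) (cong (λ v → v ℤ.- - t ℤ.* + β) (sym y₀≡))
      where
      undo₁ : ∀ X T a → X ≡ (X ℤ.+ T ℤ.* a) ℤ.+ - T ℤ.* a
      undo₁ = ℤ-Solver.solve-∀
      undo₂ : ∀ Y T b → Y ≡ (Y ℤ.- T ℤ.* b) ℤ.- - T ℤ.* b
      undo₂ = ℤ-Solver.solve-∀

  solutions-form-orbit : ∀ {x y x₀ y₀} → x * A + y * B ≡ x₀ * A + y₀ * B
    → ∃[ t ] Orbit x y x₀ y₀ t
  solutions-form-orbit {x} {y} {x₀} {y₀} eq with ≤-total x₀ x
  ... | inj₁ x₀≤x = orbit-≥ x₀≤x eq
  ... | inj₂ x≤x₀ with orbit-≥ x≤x₀ (sym eq)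
  ...   | t , orbit = - t , orbit-sym {x} {y} {x₀} {y₀} {t} orbit

  orbit-solutions : ∀ {x y x₀ y₀ t} → Orbit x y x₀ y₀ t → x * A + y * B ≡ x₀ * A + y₀ * B
  orbit-solutions {x} {y} {x₀} {y₀} {t} (x≡ , y≡) = ℤ.+-injective (begin
    + (x * A + y * B)
      ≡⟨ pos-*-+-* x A y B ⟩
    + x ℤ.* + A ℤ.+ + y ℤ.* + B
      ≡⟨ cong₂ (λ u v → u ℤ.* + A ℤ.+ v ℤ.* + B) x≡ y≡ ⟩
    (+ x₀ ℤ.+ t ℤ.* + α) ℤ.* + A ℤ.+ (+ y₀ ℤ.- t ℤ.* + β) ℤ.* + B
      ≡⟨ expand (+ x₀) (+ y₀) t (+ α) (+ A) (+ β) (+ B) ⟩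
    C ℤ.+ t ℤ.* (+ α ℤ.* + A) ℤ.- t ℤ.* (+ β ℤ.* + B)
      ≡⟨ cong (λ v → C ℤ.+ t ℤ.* v ℤ.- t ℤ.* (+ β ℤ.* + B)) relationℤ ⟩
    C ℤ.+ t ℤ.* (+ β ℤ.* + B) ℤ.- t ℤ.* (+ β ℤ.* + B)
      ≡⟨ cancel C (t ℤ.* (+ β ℤ.* + B)) ⟨
    C
      ≡⟨ pos-*-+-* x₀ A y₀ B ⟨
    + (x₀ * A + y₀ * B)
      ∎)
    where
    C : ℤ
    C = + x₀ ℤ.* + A ℤ.+ + y₀ ℤ.* + B
    relationℤ : + α ℤ.* + A ≡ + β ℤ.* + B
    relationℤ = trans (sym (ℤ.pos-* α A)) (trans (cong +_ relation) (ℤ.pos-* β B))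
    expand : ∀ X Y T a A b B → (X ℤ.+ T ℤ.* a) ℤ.* A ℤ.+ (Y ℤ.- T ℤ.* b) ℤ.* B
                             ≡ X ℤ.* A ℤ.+ Y ℤ.* B ℤ.+ T ℤ.* (a ℤ.* A) ℤ.- T ℤ.* (b ℤ.* B)
    expand = ℤ-Solver.solve-∀
    cancel : ∀ C Z → C ≡ C ℤ.+ Z ℤ.- Z
    cancel = ℤ-Solver.solve-∀

infixl 6 _⊕_
infix 7 _·e_

_⊕_ : ∀ {n} → Vec ℕ n → Vec ℕ n → Vec ℕ n
_⊕_ = zipWith _+_

_·e_ : ℕ → Fin 4 → Vec ℕ 4
m ·e i = replicate 4 0 [ i ]≔ m

φ-⊕ : ∀ d x y → φ d (x ⊕ y) ≡ φ d x + φ d y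
φ-⊕ (d0 ∷ d1 ∷ d2 ∷ d3 ∷ []) (x0 ∷ x1 ∷ x2 ∷ x3 ∷ []) (y0 ∷ y1 ∷ y2 ∷ y3 ∷ []) =
  identity d0 d1 d2 d3 x0 x1 x2 x3 y0 y1 y2 y3
  where
  identity : ∀ d0 d1 d2 d3 x0 x1 x2 x3 y0 y1 y2 y3 →
    (x0 + y0) * d0 + (x1 + y1) * d1 + (x2 + y2) * d2 + (x3 + y3) * d3
      ≡ (x0 * d0 + x1 * d1 + x2 * d2 + x3 * d3) + (y0 * d0 + y1 * d1 + y2 * d2 + y3 * d3)
  identity = solve-∀

φ-·e : ∀ d m i → φ d (m ·e i) ≡ m * lookup d i
φ-·e (_ ∷ _ ∷ _ ∷ _ ∷ []) m 0F = trans (+-identityʳ _) (trans (+-identityʳ _) (+-identityʳ _))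
φ-·e (_ ∷ _ ∷ _ ∷ _ ∷ []) m 1F = trans (+-identityʳ _) (+-identityʳ _)
φ-·e (_ ∷ _ ∷ _ ∷ _ ∷ []) m 2F = +-identityʳ _
φ-·e (_ ∷ _ ∷ _ ∷ _ ∷ []) m 3F = refl

·e-lookup-≢ : ∀ m {i j} → i ≢ j → lookup (m ·e i) j ≡ 0
·e-lookup-≢ m {i} {j} i≢j = trans (lookup∘update′ (i≢j ∘ sym) (replicate 4 0) m) (lookup-replicate j 0)

φ-exchange : ∀ d {u u′} x → φ d u ≡ φ d u′ → φ d (u ⊕ x) ≡ φ d (u′ ⊕ x)
φ-exchange d {u} {u′} x φu≡φu′ = begin
  φ d (u ⊕ x)      ≡⟨ φ-⊕ d u x ⟩
  φ d u + φ d x    ≡⟨ cong (_+ φ d x) φu≡φu′ ⟩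
  φ d u′ + φ d x   ≡⟨ φ-⊕ d u′ x ⟨
  φ d (u′ ⊕ x)     ∎

RStep-sym : ∀ {d s x y} → RStep d s x y → RStep d s y x
RStep-sym (φx≡s , φy≡s , i , xᵢ>0 , yᵢ>0) = φy≡s , φx≡s , i , yᵢ>0 , xᵢ>0

apery-∌-d₀+S : ∀ {d x} → InApery d x → ∀ z → lookup d 0F + φ d z ≢ x
apery-∌-d₀+S {d} (_ , ¬shift) z d₀+φz≡x = ¬shift
  ( subst (lookup d 0F ≤_) d₀+φz≡x (m≤m+n _ _)
  , z , sym (trans (cong (_∸ lookup d 0F) (sym d₀+φz≡x)) (m+n∸m≡n (lookup d 0F) _)))

InT-stable : ∀ {d a i j k} → ¬ ¬ InT d a i j k → InT d a i j k
InT-stable {d} {a} {i} {j} {k} ¬¬T =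
    (((0 ∷ i ∷ j ∷ k ∷ []) , refl) , λ shift → ¬¬T (λ T → proj₂ (proj₁ T) shift))
  , decidable-stable (i <? a 1F 1F) (λ i≮ → ¬¬T (i≮ ∘ proj₁ ∘ proj₂))
  , decidable-stable (j <? a 2F 2F) (λ j≮ → ¬¬T (j≮ ∘ proj₁ ∘ proj₂ ∘ proj₂))
  , decidable-stable (k <? a 3F 3F) (λ k≮ → ¬¬T (k≮ ∘ proj₂ ∘ proj₂ ∘ proj₂))

covers-trans : ∀ {v i j k i′ j′ k′}
  → Covers v i j k → Covers (+ i , + j , + k) i′ j′ k′ → Covers v i′ j′ k′
covers-trans {_ , _ , _} (x≤ , y≤ , z≤) (x≤′ , y≤′ , z≤′) =
  ℤ.≤-trans x≤ x≤′ , ℤ.≤-trans y≤ y≤′ , ℤ.≤-trans z≤ z≤′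

module _ {d a} {V : PointSet} (isV : IsV d a V) where

  private
    admissible : ∀ v → V v → Admissible d v
    admissible = proj₁ (proj₁ isV)
    leaves : Leaves d a V
    leaves = proj₂ (proj₁ isV)
    minimal : ∀ W → (∀ v → W v → V v) → GoodSet d a W → ∀ v → V v → W v
    minimal = proj₂ isV

  -- Were [[i,j,k]] deleted by some v ∈ V, then v ≠ p would delete every cube p deletes,
  -- and V ∖ {p} would still be a good set.
  essential-cube : ∀ {p i j k} → V p → ¬ Covers p i j k
    → (∀ {i′ j′ k′} → Covers p i′ j′ k′ → Covers (+ i , + j , + k) i′ j′ k′)
    → InT d a i j k
  essential-cube {p} {i} {j} {k} Vp ¬covers dominated =
    InT-stable {d} {a} λ ¬T → ¬T (proj₂ (leaves i j k) λ (v , Vv , covers) → p∉W Vv covers)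
    where
    W : PointSet
    W u = V u × u ≢ p
    W-good : ∀ {v} → V v → Covers v i j k → GoodSet d a W
    W-good {v} Vv v-covers = (λ u → admissible u ∘ proj₁) , λ i′ j′ k′ →
        (λ T (u , Wu , covers) → proj₁ (leaves i′ j′ k′) T (u , proj₁ Wu , covers))
      , λ ¬coveredW → proj₂ (leaves i′ j′ k′) λ (u , Vu , covers) →
          ¬coveredW (u , (Vu , λ { refl →
            ¬coveredW (v , (Vv , v≢p) , covers-trans v-covers (dominated covers)) }) , covers)
      where
      v≢p : v ≢ p
      v≢p refl = ¬covers v-covers
    p∉W : ∀ {v} → V v → Covers v i j k → ⊥
    p∉W Vv covers = proj₂ (minimal W (λ _ → proj₁) (W-good Vv covers) p Vp) refl

  corner-cubes-in-T : ∀ {l1 m2 m3} → V (- (+ l1) , + suc m2 , + suc m3)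
    → InT d a 0 m2 (suc m3) × InT d a 0 (suc m2) m3
  corner-cubes-in-T Vp =
      essential-cube Vp (λ { (_ , +≤+ l2≤m2 , _) → 1+n≰n l2≤m2 })
        (λ { (_ , j≥ , k≥) → +≤+ z≤n , ℤ.≤-trans (+≤+ (n≤1+n _)) j≥ , k≥ })
    , essential-cube Vp (λ { (_ , _ , +≤+ l3≤m3) → 1+n≰n l3≤m3 })
        (λ { (_ , j≥ , k≥) → +≤+ z≤n , j≥ , ℤ.≤-trans (+≤+ (n≤1+n _)) k≥ })

module NumericalSemigroup (d0 d1 d2 d3 : ℕ) (a : Fin 4 → Fin 4 → ℕ)
  (emb : EmbDim4 (d0 ∷ d1 ∷ d2 ∷ d3 ∷ [])) (mr : MinimalRelations (d0 ∷ d1 ∷ d2 ∷ d3 ∷ []) a) where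

  d : Vec ℕ 4
  d = d0 ∷ d1 ∷ d2 ∷ d3 ∷ []

  generator-positive : ∀ i → 0 < lookup d i
  generator-positive i = n≢0⇒n>0 λ dᵢ≡0 →
    proj₂ emb i (replicate 4 0 , lookup-replicate i 0 , sym dᵢ≡0)

  diagonal-positive : ∀ i → 0 < a i i
  diagonal-positive i = proj₁ (mr i)

  minimal-multiple : ∀ i {m} → 0 < m → InSWithout d i (m * lookup d i) → a i i ≤ m
  minimal-multiple i = proj₂ (proj₂ (mr i)) _

  no-multiple-below : ∀ i {m} → 0 < m → m < a i i → ¬ InSWithout d i (m * lookup d i)
  no-multiple-below i m>0 m<aᵢᵢ = <⇒≱ m<aᵢᵢ ∘ minimal-multiple i m>0

  multiple-vanishes : ∀ i {m} → m * lookup d i ≡ 0 → m ≡ 0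
  multiple-vanishes i = m*n≡0⇒m≡0 _ _ ⦃ >-nonZero (generator-positive i) ⦄

  φ-on-d₀d₁ : ∀ z0 z1 → φ d (z0 ∷ z1 ∷ 0 ∷ 0 ∷ []) ≡ z0 * d0 + z1 * d1
  φ-on-d₀d₁ z0 z1 = trans (+-identityʳ _) (+-identityʳ _)

  φ-trade : ∀ i x → φ d (a i i ·e i ⊕ x) ≡ φ d (offDiag a i ⊕ x)
  φ-trade i x = φ-exchange d {a i i ·e i} {offDiag a i} x (trans (φ-·e d (a i i) i) (proj₁ (proj₂ (mr i))))

  -- A record rather than an equation so that i and j can be inferred from a proof.
  record Binomial (i j : Fin 4) : Set where
    constructor binomial
    field offDiag≡ : offDiag a i ≡ a i j ·e j

  binomial-relation : ∀ {i j} → Binomial i j → a i i * lookup d i ≡ a i j * lookup d j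
  binomial-relation {i} {j} (binomial offDiag≡) = begin
    a i i * lookup d i    ≡⟨ proj₁ (proj₂ (mr i)) ⟩
    φ d (offDiag a i)     ≡⟨ cong (φ d) offDiag≡ ⟩
    φ d (a i j ·e j)      ≡⟨ φ-·e d (a i j) j ⟩
    a i j * lookup d j    ∎

  binomial-bound : ∀ {i j} → i ≢ j → Binomial i j → a j j ≤ a i j
  binomial-bound {i} {j} i≢j bᵢⱼ = minimal-multiple j aᵢⱼ>0
    (a i i ·e i , ·e-lookup-≢ (a i i) i≢j , trans (φ-·e d (a i i) i) (binomial-relation bᵢⱼ))
    where
    aᵢⱼ>0 : 0 < a i j
    aᵢⱼ>0 = positive-coefficient (binomial-relation bᵢⱼ) (diagonal-positive i) (generator-positive i)

  binomial-relations-coincide : ∀ {i j} → i ≢ j → Binomial i j → Binomial j i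
    → a i i * lookup d i ≡ a j j * lookup d j
  binomial-relations-coincide {i} {j} i≢j bᵢⱼ bⱼᵢ = ≤-antisym
    (≤-trans (*-monoˡ-≤ (lookup d i) (binomial-bound (i≢j ∘ sym) bⱼᵢ))
             (≤-reflexive (sym (binomial-relation bⱼᵢ))))
    (≤-trans (*-monoˡ-≤ (lookup d j) (binomial-bound i≢j bᵢⱼ))
             (≤-reflexive (sym (binomial-relation bᵢⱼ))))

  relation-shape₀ : (0 < a 0F 2F ⊎ 0 < a 0F 3F) ⊎ Binomial 0F 1F
  relation-shape₀ with a 0F 2F in a₀₂≡ | a 0F 3F in a₀₃≡
  ... | suc _ | _     = inj₁ (inj₁ z<s)
  ... | zero  | suc _ = inj₁ (inj₂ z<s)
  ... | zero  | zero  = inj₂ (binomial (cong₂ (λ u v → 0 ∷ a 0F 1F ∷ u ∷ v ∷ []) a₀₂≡ a₀₃≡))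

  relation-shape₁ : (0 < a 1F 2F ⊎ 0 < a 1F 3F) ⊎ Binomial 1F 0F
  relation-shape₁ with a 1F 2F in a₁₂≡ | a 1F 3F in a₁₃≡
  ... | suc _ | _     = inj₁ (inj₁ z<s)
  ... | zero  | suc _ = inj₁ (inj₂ z<s)
  ... | zero  | zero  = inj₂ (binomial (cong₂ (λ u v → a 1F 0F ∷ 0 ∷ u ∷ v ∷ []) a₁₂≡ a₁₃≡))

  module Fibre (l0 l1 m2 m3 : ℕ) (l0>0 : 0 < l0) (l1>0 : 0 < l1)
    (E : l0 * d0 + l1 * d1 ≡ suc m2 * d2 + suc m3 * d3)
    (T₂ : InT d a 0 m2 (suc m3)) (T₃ : InT d a 0 (suc m2) m3) where

    l2 l3 s : ℕ
    l2 = suc m2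
    l3 = suc m3
    s = l0 * d0 + l1 * d1

    InFibre : Vec ℕ 4 → Set
    InFibre z = φ d z ≡ s

    z₀₁ z₂₃ : Vec ℕ 4
    z₀₁ = l0 ∷ l1 ∷ 0 ∷ 0 ∷ []
    z₂₃ = 0 ∷ 0 ∷ l2 ∷ l3 ∷ []

    z₀₁∈F : InFibre z₀₁
    z₀₁∈F = φ-on-d₀d₁ l0 l1

    z₂₃∈F : InFibre z₂₃
    z₂₃∈F = sym E

    private
      apery-blocks-d₀ : ∀ {x} dₖ y → InApery d x → dₖ + x ≡ s → dₖ + (d0 + φ d y) ≡ s → ⊥
      apery-blocks-d₀ dₖ y x∈Ap dₖ+x≡s dₖ+d₀+φy≡s =
        apery-∌-d₀+S {d} x∈Ap y (+-cancelˡ-≡ dₖ _ _ (trans dₖ+d₀+φy≡s (sym dₖ+x≡s)))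

    d₀-excludes-d₂d₃ : ∀ z → InFibre z → 0 < lookup z 2F ⊎ 0 < lookup z 3F → lookup z 0F ≡ 0
    d₀-excludes-d₂d₃ (zero ∷ _ ∷ _ ∷ _ ∷ []) _ _ = refl
    d₀-excludes-d₂d₃ (suc y0 ∷ z1 ∷ suc y2 ∷ z3 ∷ []) z∈F (inj₁ _) =
      ⊥-elim (apery-blocks-d₀ d2 (y0 ∷ z1 ∷ y2 ∷ z3 ∷ []) (proj₁ T₂)
        (sym (trans E (+-assoc d2 (m2 * d2) (l3 * d3)))) (trans (peel d0 d1 d2 d3 y0 z1 y2 z3) z∈F))
      where
      peel : ∀ d0 d1 d2 d3 y0 z1 y2 z3 → d2 + (d0 + (y0 * d0 + z1 * d1 + y2 * d2 + z3 * d3))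
                                         ≡ suc y0 * d0 + z1 * d1 + suc y2 * d2 + z3 * d3
      peel = solve-∀
    d₀-excludes-d₂d₃ (suc y0 ∷ z1 ∷ z2 ∷ suc y3 ∷ []) z∈F (inj₂ _) =
      ⊥-elim (apery-blocks-d₀ d3 (y0 ∷ z1 ∷ z2 ∷ y3 ∷ []) (proj₁ T₃)
        (sym (trans E (shift d2 d3 l2 m3))) (trans (peel d0 d1 d2 d3 y0 z1 z2 y3) z∈F))
      where
      shift : ∀ d2 d3 l2 m3 → l2 * d2 + suc m3 * d3 ≡ d3 + (l2 * d2 + m3 * d3)
      shift = solve-∀
      peel : ∀ d0 d1 d2 d3 y0 z1 z2 y3 → d3 + (d0 + (y0 * d0 + z1 * d1 + z2 * d2 + y3 * d3))
                                         ≡ suc y0 * d0 + z1 * d1 + z2 * d2 + suc y3 * d3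
      peel = solve-∀
    d₀-excludes-d₂d₃ (suc _ ∷ _ ∷ zero ∷ _    ∷ []) _ (inj₁ ())
    d₀-excludes-d₂d₃ (suc _ ∷ _ ∷ _    ∷ zero ∷ []) _ (inj₂ ())

    fibre-without-d₀ : ∀ {z1 z2 z3} → z1 < a 1F 1F → InFibre (0 ∷ z1 ∷ z2 ∷ z3 ∷ [])
      → z1 ≡ 0 × z2 ≡ l2 × z3 ≡ l3
    fibre-without-d₀ {z1} {z2} {z3} z1<a₁₁ z∈F
      with cancel-common-multiple {Y = l2 * d2} z3 l3 (trans z∈F E)
    ... | inj₁ (e3 , refl , eq₃)
      with cancel-common-multiple {Y = 0} z2 l2
             (trans (sym (xy∙z≈xz∙y +-commutativeSemigroup (z1 * d1) (z2 * d2) (e3 * d3))) eq₃)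
    ...   | inj₁ (e2 , refl , eq₂) =
      z1≡0 , trans (cong (_+_ l2) e2≡0) (+-identityʳ l2) , trans (cong (_+_ l3) e3≡0) (+-identityʳ l3)
      where
      z1≡0 : z1 ≡ 0
      z1≡0 = multiple-vanishes 1F (m+n≡0⇒m≡0 (z1 * d1) (m+n≡0⇒m≡0 (z1 * d1 + e3 * d3) eq₂))
      e3≡0 : e3 ≡ 0
      e3≡0 = multiple-vanishes 3F (m+n≡0⇒n≡0 (z1 * d1) (m+n≡0⇒m≡0 (z1 * d1 + e3 * d3) eq₂))
      e2≡0 : e2 ≡ 0
      e2≡0 = multiple-vanishes 2F (m+n≡0⇒n≡0 (z1 * d1 + e3 * d3) eq₂)
    ...   | inj₂ (e2 , l2≡ , eq₂) = ⊥-elim (no-multiple-below 2F z<s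
      (summand-< l2≡ (proj₁ (proj₂ (proj₂ T₃))))
      ((0 ∷ z1 ∷ 0 ∷ e3 ∷ []) , refl , trans (cong (_+ e3 * d3) (+-identityʳ _)) eq₂))
    fibre-without-d₀ {z1} {z2} {z3} z1<a₁₁ z∈F | inj₂ (e3 , l3≡ , eq₃)
      with cancel-common-multiple {Y = suc e3 * d3} z2 l2 (trans eq₃ (+-comm (l2 * d2) (suc e3 * d3)))
    ...   | inj₁ (e2 , refl , eq₂) = ⊥-elim (no-multiple-below 3F z<s
      (summand-< l3≡ (proj₂ (proj₂ (proj₂ T₂))))
      ((0 ∷ z1 ∷ e2 ∷ 0 ∷ []) , refl , trans (+-identityʳ _) eq₂))
    ...   | inj₂ (e2 , l2≡ , eq₂) = ⊥-elim (no-multiple-below 1F z1>0 z1<a₁₁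
      ((0 ∷ 0 ∷ suc e2 ∷ suc e3 ∷ []) , refl , trans (+-comm (suc e2 * d2) (suc e3 * d3)) (sym eq₂)))
      where
      z1>0 : 0 < z1
      z1>0 = n≢0⇒n>0 λ { refl →
        1+n≢0 (multiple-vanishes 3F {suc e3} (m+n≡0⇒m≡0 (suc e3 * d3) (sym eq₂))) }

    trade : ∀ i x → InFibre (a i i ·e i ⊕ x) → InFibre (offDiag a i ⊕ x)
    trade i x = trans (sym (φ-trade i x))

    traded-binomial : ∀ {i j x} → Binomial i j → InFibre (offDiag a i ⊕ x) → InFibre (a i j ·e j ⊕ x)
    traded-binomial {x = x} (binomial offDiag≡) = subst (λ r → InFibre (r ⊕ x)) offDiag≡

    private
      pad : ∀ {m n} → 0 < m ⊎ 0 < n → 0 < m + 0 ⊎ 0 < n + 0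
      pad = Sum.map (m≤n⇒m≤n+o 0) (m≤n⇒m≤n+o 0)

    module Coincident (coincide : a 0F 0F * d0 ≡ a 1F 1F * d1) where

      d₁-bounded : ∀ {z0 z1 z2 z3} → InFibre (z0 ∷ z1 ∷ z2 ∷ z3 ∷ []) → 0 < z2 ⊎ 0 < z3 → z1 < a 1F 1F
      d₁-bounded {z0} {z1} {z2} {z3} z∈F uses-d₂d₃ with a 1F 1F ≤? z1
      ... | no a₁₁≰z1 = ≰⇒> a₁₁≰z1
      ... | yes a₁₁≤z1 with m≤n⇒∃[o]m+o≡n a₁₁≤z1
      ...   | f , refl = contradiction
        (m+n≡0⇒m≡0 (a 0F 0F) (d₀-excludes-d₂d₃ (a 0F 0F + z0 ∷ f ∷ z2 ∷ z3 ∷ []) exchanged uses-d₂d₃))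
        (n>0⇒n≢0 (diagonal-positive 0F))
        where
        pivots : φ d (a 1F 1F ·e 1F) ≡ φ d (a 0F 0F ·e 0F)
        pivots = trans (φ-·e d (a 1F 1F) 1F) (trans (sym coincide) (sym (φ-·e d (a 0F 0F) 0F)))
        exchanged : InFibre (a 0F 0F + z0 ∷ f ∷ z2 ∷ z3 ∷ [])
        exchanged =
          trans (sym (φ-exchange d {a 1F 1F ·e 1F} {a 0F 0F ·e 0F} (z0 ∷ f ∷ z2 ∷ z3 ∷ []) pivots)) z∈F

      meets-d₂d₃⇒z₂₃ : ∀ {z} → InFibre z → 0 < lookup z 2F ⊎ 0 < lookup z 3F → z ≡ z₂₃
      meets-d₂d₃⇒z₂₃ {z@(z0 ∷ z1 ∷ z2 ∷ z3 ∷ [])} z∈F uses-d₂d₃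
        with d₀-excludes-d₂d₃ z z∈F uses-d₂d₃
      ... | refl with fibre-without-d₀ {z1} {z2} {z3} (d₁-bounded {0} {z1} {z2} {z3} z∈F uses-d₂d₃) z∈F
      ...   | refl , refl , refl = refl

      z₂₃-isolated : ∀ {z} → RRel d s z₂₃ z → z ≡ z₂₃
      z₂₃-isolated r = fold (λ x y → x ≡ z₂₃ → y ≡ z₂₃) (λ step rest → rest ∘ stays step) id r refl
        where
        stays : ∀ {x y} → RStep d s x y → x ≡ z₂₃ → y ≡ z₂₃
        stays (_ , y∈F , 2F , _ , y₂>0) refl = meets-d₂d₃⇒z₂₃ y∈F (inj₁ y₂>0)
        stays (_ , y∈F , 3F , _ , y₃>0) refl = meets-d₂d₃⇒z₂₃ y∈F (inj₂ y₃>0)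
        stays (_ , _   , 0F , () , _)   refl
        stays (_ , _   , 1F , () , _)   refl

      betti : IsBetti d s
      betti = z₂₃ , z₀₁ , z₂₃∈F , z₀₁∈F ,
        λ r → n>0⇒n≢0 l0>0 (cong (λ z → lookup z 0F) (z₂₃-isolated r))

      open TwoTermEquation {d0} {d1} {a 0F 0F} {a 1F 1F}
        ⦃ >-nonZero (diagonal-positive 0F) ⦄ ⦃ >-nonZero (generator-positive 1F) ⦄ coincide
        (λ {r} {c} r>0 rd₀≡cd₁ →
          minimal-multiple 0F r>0 (c ·e 1F , refl , trans (φ-·e d c 1F) (sym rd₀≡cd₁)))

      fibre⊆claimed : ∀ z → InFibre z → InClaimedFiber a l0 l1 l2 l3 z
      fibre⊆claimed (_ ∷ _ ∷ suc _ ∷ _ ∷ [])     z∈F = inj₁ (meets-d₂d₃⇒z₂₃ z∈F (inj₁ z<s))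
      fibre⊆claimed (_ ∷ _ ∷ zero ∷ suc _ ∷ [])  z∈F = inj₁ (meets-d₂d₃⇒z₂₃ z∈F (inj₂ z<s))
      fibre⊆claimed (z0 ∷ z1 ∷ zero ∷ zero ∷ []) z∈F
        with solutions-form-orbit {z0} {z1} {l0} {l1} (trans (sym (φ-on-d₀d₁ z0 z1)) z∈F)
      ... | t , z0≡ , z1≡ = inj₂ (t , nonnegative z0≡ , nonnegative z1≡ , z0≡ , z1≡ , refl , refl)
        where
        nonnegative : ∀ {n k} → + n ≡ k → k ℤ.≥ + 0
        nonnegative refl = +≤+ z≤n

      claimed⊆fibre : ∀ z → InClaimedFiber a l0 l1 l2 l3 z → InFibre z
      claimed⊆fibre _ (inj₁ refl) = z₂₃∈F
      claimed⊆fibre (z0 ∷ z1 ∷ _ ∷ _ ∷ []) (inj₂ (t , _ , _ , z0≡ , z1≡ , refl , refl)) =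
        trans (φ-on-d₀d₁ z0 z1) (orbit-solutions {z0} {z1} {l0} {l1} {t} (z0≡ , z1≡))

    Mixed : Set
    Mixed = ∃[ w ] InFibre w × 0 < lookup w 1F × (0 < lookup w 2F ⊎ 0 < lookup w 3F)

    link : ∀ x y → InFibre x → InFibre y → SuppMeet x y → RRel d s x y
    link _ _ x∈F y∈F meet = (x∈F , y∈F , meet) ◅ ε

    connected-to-z₀₁ : Mixed → ∀ z → InFibre z → RRel d s z z₀₁
    connected-to-z₀₁ _ z@(suc _ ∷ _ ∷ _ ∷ _ ∷ [])    z∈F = link z z₀₁ z∈F z₀₁∈F (0F , z<s , l0>0)
    connected-to-z₀₁ _ z@(zero ∷ suc _ ∷ _ ∷ _ ∷ []) z∈F = link z z₀₁ z∈F z₀₁∈F (1F , z<s , l1>0)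
    connected-to-z₀₁ (w , w∈F , w₁>0 , w-uses-d₂d₃) (zero ∷ zero ∷ z2 ∷ z3 ∷ []) z∈F
      with fibre-without-d₀ {0} {z2} {z3} (diagonal-positive 1F) z∈F
    ... | _ , refl , refl =
      link z₂₃ w z₂₃∈F w∈F (meet w-uses-d₂d₃) ◅◅ link w z₀₁ w∈F z₀₁∈F (1F , w₁>0 , l1>0)
      where
      meet : 0 < lookup w 2F ⊎ 0 < lookup w 3F → SuppMeet z₂₃ w
      meet (inj₁ w₂>0) = 2F , z<s , w₂>0
      meet (inj₂ w₃>0) = 3F , z<s , w₃>0

    mixed⇒¬betti : Mixed → ¬ IsBetti d s
    mixed⇒¬betti mixed (z , z′ , z∈F , z′∈F , unrelated) = unrelated
      (connected-to-z₀₁ mixed z z∈F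
        ◅◅ reverse (λ {x} {y} → RStep-sym {d} {s} {x} {y}) (connected-to-z₀₁ mixed z′ z′∈F))

    mixed-after-binomial₀ : ∀ {x0 x1} → 0 < x1 → Binomial 0F 1F → InFibre (x0 ∷ a 0F 1F + x1 ∷ 0 ∷ 0 ∷ [])
      → a 0F 0F * d0 ≢ a 1F 1F * d1 → Mixed
    mixed-after-binomial₀ {x0} {x1} x1>0 b₀₁ x∈F distinct with relation-shape₁
    ... | inj₂ b₁₀ = contradiction (binomial-relations-coincide (λ ()) b₀₁ b₁₀) distinct
    ... | inj₁ uses-d₂d₃ =
      offDiag a 1F ⊕ y , trade 1F y resplit , m≤n⇒m≤o+n (a 0F 1F ∸ a 1F 1F) x1>0 , pad uses-d₂d₃
      where
      y : Vec ℕ 4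
      y = x0 ∷ a 0F 1F ∸ a 1F 1F + x1 ∷ 0 ∷ 0 ∷ []
      resplit : InFibre (a 1F 1F ·e 1F ⊕ y)
      resplit = subst (λ c → InFibre (x0 ∷ c ∷ 0 ∷ 0 ∷ [])) (+-split x1 (binomial-bound (λ ()) b₀₁)) x∈F

    mixed-from-d₀-surplus : ∀ {x0 x1} → a 0F 0F ≤ x0 → 0 < x1 → InFibre (x0 ∷ x1 ∷ 0 ∷ 0 ∷ [])
      → a 0F 0F * d0 ≢ a 1F 1F * d1 → Mixed
    mixed-from-d₀-surplus {x0} {x1} a₀₀≤x0 x1>0 x∈F distinct with m≤n⇒∃[o]m+o≡n a₀₀≤x0
    ... | f , refl with relation-shape₀
    ...   | inj₁ uses-d₂d₃ = offDiag a 0F ⊕ y , trade 0F y x∈F , m≤n⇒m≤o+n (a 0F 1F) x1>0 , pad uses-d₂d₃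
      where
      y : Vec ℕ 4
      y = f ∷ x1 ∷ 0 ∷ 0 ∷ []
    ...   | inj₂ b₀₁ = mixed-after-binomial₀ {f} {x1} x1>0 b₀₁
      (traded-binomial {x = f ∷ x1 ∷ 0 ∷ 0 ∷ []} b₀₁ (trade 0F (f ∷ x1 ∷ 0 ∷ 0 ∷ []) x∈F)) distinct

    d₁-surplus⇒coincide : ∀ {x0 x1} → 0 < x0 → a 1F 1F ≤ x1 → InFibre (x0 ∷ x1 ∷ 0 ∷ 0 ∷ [])
      → a 0F 0F * d0 ≡ a 1F 1F * d1
    d₁-surplus⇒coincide {x0} {x1} x0>0 a₁₁≤x1 x∈F with m≤n⇒∃[o]m+o≡n a₁₁≤x1
    ... | f , refl with relation-shape₁
    ...   | inj₁ uses-d₂d₃ = contradiction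
      (m+n≡0⇒n≡0 (a 1F 0F) (d₀-excludes-d₂d₃ (offDiag a 1F ⊕ y) (trade 1F y x∈F) (pad uses-d₂d₃)))
      (n>0⇒n≢0 x0>0)
      where
      y : Vec ℕ 4
      y = x0 ∷ f ∷ 0 ∷ 0 ∷ []
    ...   | inj₂ b₁₀ with relation-shape₀
    ...     | inj₂ b₀₁ = binomial-relations-coincide (λ ()) b₀₁ b₁₀
    ...     | inj₁ uses-d₂d₃ = contradiction
      (m+n≡0⇒n≡0 (a 1F 0F ∸ a 0F 0F)
        (d₀-excludes-d₂d₃ (offDiag a 0F ⊕ y) (trade 0F y resplit) (pad uses-d₂d₃)))
      (n>0⇒n≢0 x0>0)
      where
      y : Vec ℕ 4
      y = a 1F 0F ∸ a 0F 0F + x0 ∷ f ∷ 0 ∷ 0 ∷ []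
      resplit : InFibre (a 0F 0F ·e 0F ⊕ y)
      resplit = subst (λ c → InFibre (c ∷ f ∷ 0 ∷ 0 ∷ [])) (+-split x0 (binomial-bound (λ ()) b₁₀))
        (traded-binomial {x = x0 ∷ f ∷ 0 ∷ 0 ∷ []} b₁₀ (trade 1F (x0 ∷ f ∷ 0 ∷ 0 ∷ []) x∈F))

    distinct⇒¬betti : a 0F 0F * d0 ≢ a 1F 1F * d1 → a 0F 0F ≤ l0 ⊎ a 1F 1F ≤ l1 → ¬ IsBetti d s
    distinct⇒¬betti distinct (inj₁ a₀₀≤l0) =
      mixed⇒¬betti (mixed-from-d₀-surplus a₀₀≤l0 l1>0 z₀₁∈F distinct)
    distinct⇒¬betti distinct (inj₂ a₁₁≤l1) =
      contradiction (d₁-surplus⇒coincide l0>0 a₁₁≤l1 z₀₁∈F) distinct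

lemma3p9 : (d : Vec ℕ 4) (a : Fin 4 → Fin 4 → ℕ) → EmbDim4 d → MinimalRelations d a
    → AtMostOneZero (a 1F 0F) (a 2F 0F) (a 3F 0F)
    → (V : PointSet) → IsV d a V
    → (l0 l1 l2 l3 : ℕ) → 0 < l0 → 0 < l1 → 0 < l2 → 0 < l3
    → V (- (+ l1) , + l2 , + l3)
    → l0 * lookup d 0F + l1 * lookup d 1F ≡ l2 * lookup d 2F + l3 * lookup d 3F
    → (a 0F 0F ≤ l0 ⊎ a 1F 1F ≤ l1)
    → (a 0F 0F * lookup d 0F ≢ a 1F 1F * lookup d 1F
        → ¬ IsBetti d (l0 * lookup d 0F + l1 * lookup d 1F))
    × (a 0F 0F * lookup d 0F ≡ a 1F 1F * lookup d 1F
        → IsBetti d (l0 * lookup d 0F + l1 * lookup d 1F)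
        × (∀ (z : Vec ℕ 4) →
            (φ d z ≡ l0 * lookup d 0F + l1 * lookup d 1F → InClaimedFiber a l0 l1 l2 l3 z)
            × (InClaimedFiber a l0 l1 l2 l3 z → φ d z ≡ l0 * lookup d 0F + l1 * lookup d 1F)))
-- The argument does not use the hypothesis that at most one of a₁₀, a₂₀, a₃₀ vanishes.
lemma3p9 (d0 ∷ d1 ∷ d2 ∷ d3 ∷ []) a emb mr _ V isV l0 l1 (suc m2) (suc m3) l0>0 l1>0 _ _ Vp E large =
    (λ distinct → distinct⇒¬betti distinct large)
  , (λ coincide → let open Coincident coincide in betti , λ z → fibre⊆claimed z , claimed⊆fibre z)
  where
  open NumericalSemigroup d0 d1 d2 d3 a emb mr
  corners : InT d a 0 m2 (suc m3) × InT d a 0 (suc m2) m3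
  corners = corner-cubes-in-T {d} {a} isV Vp
  open Fibre l0 l1 m2 m3 l0>0 l1>0 E (proj₁ corners) (proj₂ corners)
lemma3p9 _ _ _ _ _ _ _ _ _ zero    _    _ _ () _ _ _ _
lemma3p9 _ _ _ _ _ _ _ _ _ (suc _) zero _ _ _ () _ _ _
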